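{- For all store terms $s,t$: $\vdash s=t$ if and only if $s\simeq t$, where $s\simeq t$ means that $\mathrm{dom}(s)=\mathrm{dom}(t)$ and $\vdash\mathrm{lkp}_\ell(s)=\mathrm{lkp}_\ell(t)$ for every $\ell\in\mathrm{dom}(s)$.
   Context: Fix a countably infinite set $\mathbf{L}$ of locations. Values are the terms $V ::= x\mid\lambda x.M$ of an untyped calculus (their structure is irrelevant here; values are treated as constants). Store terms $s,t ::= \mathrm{emp} \mid \mathrm{upd}_\ell(u,s)$ and lookup terms $u ::= V \mid \mathrm{lkp}_\ell(s)$ ($\ell\in\mathbf{L}$), where $\mathrm{lkp}_\ell(s)$ is well formed only if $\ell\in\mathrm{dom}(s)$; $\mathrm{dom}(\mathrm{emp})=\emptyset$, $\mathrm{dom}(\mathrm{upd}_\ell(u,s))=\{\ell\}\cup\mathrm{dom}(s)$. $\vdash a=b$ means that the equation between well-formed store terms or lookup terms is derivable in equational logic (reflexivity, symmetry, transitivity, congruence) from the axioms: (1) $\mathrm{lkp}_\ell(\mathrm{upd}_\ell(u,s))=u$; (2) $\mathrm{lkp}_\ell(\mathrm{upd}_{\ell'}(u,s))=\mathrm{lkp}_\ell(s)$ if $\ell\neq\ell'$; (3) $\mathrm{upd}_\ell(\mathrm{lkp}_\ell(s),s)=s$; (4) $\mathrm{upd}_\ell(U,\mathrm{upd}_\ell(W,s))=\mathrm{upd}_\ell(U,s)$; (5) $\mathrm{upd}_\ell(U,\mathrm{upd}_{\ell'}(W,s))=\mathrm{upd}_{\ell'}(W,\mathrm{upd}_\ell(U,s))$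 if $\ell\ne\ell'$ ($U,W$ values). -}

module Defs where

open import Data.Nat using (ℕ)
open import Relation.Binary.PropositionalEquality using (_≡_; _≢_)
open import Data.Product using (_×_)
open import Function.Bundles using (_⇔_)

Loc : Set
Loc = ℕ

data Λ : Set where
  var : ℕ → Λ
  lam : ℕ → Λ → Λ
  app : Λ → Λ → Λ

-- Values V ::= x | λx.M  (treated as constants by the store theory).
data Val : Set where
  vvar : ℕ → Val
  vlam : ℕ → Λ → Val

mutual
  data Store : Set where
    emp : Store
    upd : Loc → Lookup → Store → Store

  data Lookup : Set where
    val : Val → Lookup
    lkp : Loc → Store → Lookup

data _∈dom_ : Loc → Store → Set where
  here  : ∀ {ℓ u s} → ℓ ∈dom upd ℓ u s
  there : ∀ {ℓ ℓ' u s} → ℓ ∈dom s → ℓ ∈dom upd ℓ' u s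

mutual
  data WfS : Store → Set where
    emp : WfS emp
    upd : ∀ {ℓ u s} → WfL u → WfS s → WfS (upd ℓ u s)

  data WfL : Lookup → Set where
    val : ∀ {V} → WfL (val V)
    lkp : ∀ {ℓ s} → WfS s → ℓ ∈dom s → WfL (lkp ℓ s)

-- Derivability in equational logic from axioms (1)-(5), between
-- well-formed terms (every rule instance only involves well-formed terms).
infix 4 _≈S_ _≈L_

mutual
  data _≈S_ : Store → Store → Set where
    reflS  : ∀ {s} → WfS s → s ≈S s
    symS   : ∀ {s t} → s ≈S t → t ≈S s
    transS : ∀ {s t r} → s ≈S t → t ≈S r → s ≈S r
    congUpd : ∀ {ℓ u u' s s'} → u ≈L u' → s ≈S s' → upd ℓ u s ≈S upd ℓ u' s'
    ax3 : ∀ {ℓ s} → WfS s → ℓ ∈dom s → upd ℓ (lkp ℓ s) s ≈S s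
    ax4 : ∀ {ℓ U W s} → WfS s → upd ℓ (val U) (upd ℓ (val W) s) ≈S upd ℓ (val U) s
    ax5 : ∀ {ℓ ℓ' U W s} → ℓ ≢ ℓ' → WfS s →
          upd ℓ (val U) (upd ℓ' (val W) s) ≈S upd ℓ' (val W) (upd ℓ (val U) s)

  data _≈L_ : Lookup → Lookup → Set where
    reflL  : ∀ {u} → WfL u → u ≈L u
    symL   : ∀ {u v} → u ≈L v → v ≈L u
    transL : ∀ {u v w} → u ≈L v → v ≈L w → u ≈L w
    congLkp : ∀ {ℓ s s'} → ℓ ∈dom s → ℓ ∈dom s' → s ≈S s' → lkp ℓ s ≈L lkp ℓ s'
    ax1 : ∀ {ℓ u s} → WfL u → WfS s → lkp ℓ (upd ℓ u s) ≈L u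
    ax2 : ∀ {ℓ ℓ' u s} → ℓ ≢ ℓ' → WfL u → WfS s → ℓ ∈dom s →
          lkp ℓ (upd ℓ' u s) ≈L lkp ℓ s

_≃_ : Store → Store → Set
s ≃ t = (∀ ℓ → (ℓ ∈dom s) ⇔ (ℓ ∈dom t)) × (∀ ℓ → ℓ ∈dom s → lkp ℓ s ≈L lkp ℓ t)

{-# OPTIONS --safe #-}
-- Read a store as the finite partial map Loc ⇀ Val it denotes.  The axioms
-- are laws of point updates of maps, so derivable equations hold in this
-- semantics, and s ≃ t says exactly that s and t denote the same map.
-- Conversely every well-formed store is provably equal to a store of value
-- updates, and two such stores denoting the same map are provably equal:
-- using (3), (4) and (5) a location of the first one can be moved to the
-- front of both, its other occurrences erased, and the rest compared by
-- induction on length.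
module Submission where

open import Defs
open import Data.Maybe using (Maybe; just; nothing; fromMaybe)
open import Data.Maybe.Properties using (just-injective)
open import Data.Nat using (ℕ; suc; _<_; _≤_; _≟_; s≤s)
open import Data.Nat.Induction using (<-wellFounded)
open import Data.Nat.Properties using (≤-refl; m≤n⇒m≤1+n)
open import Data.Product using (_,_)
open import Function using (_∘_)
open import Function.Bundles using (_⇔_; mk⇔; Equivalence)
open import Induction.WellFounded using (Acc; acc)
open import Relation.Nullary using (yes; no; contradiction)
open import Relation.Binary.PropositionalEquality

Map : Set
Map = Loc → Maybe Val

_[_≔_] : Map → Loc → Maybe Val → Map
(σ [ ℓ ≔ m ]) k with k ≟ ℓ
... | yes _ = m
... | no _  = σ k

private
  variable
    σ τ : Map
    k ℓ ℓ′ : Loc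
    m n : Maybe Val
    V : Val
    u u′ : Lookup
    s t : Store

≔-same : (σ [ ℓ ≔ m ]) ℓ ≡ m
≔-same {ℓ = ℓ} with ℓ ≟ ℓ
... | yes _  = refl
... | no ℓ≢ℓ = contradiction refl ℓ≢ℓ

≔-other : k ≢ ℓ → (σ [ ℓ ≔ m ]) k ≡ σ k
≔-other {k} {ℓ} k≢ℓ with k ≟ ℓ
... | yes k≡ℓ = contradiction k≡ℓ k≢ℓ
... | no _    = refl

≔-overwrite : (σ [ ℓ ≔ n ]) [ ℓ ≔ m ] ≗ σ [ ℓ ≔ m ]
≔-overwrite {σ} {ℓ} {n} k with k ≟ ℓ
... | yes _  = refl
... | no k≢ℓ = ≔-other {σ = σ} {m = n} k≢ℓ

≔-self : σ ℓ ≡ m → σ [ ℓ ≔ m ] ≗ σ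
≔-self {ℓ = ℓ} σℓ≡m k with k ≟ ℓ
... | yes refl = sym σℓ≡m
... | no _     = refl

≔-comm : ℓ ≢ ℓ′ → (σ [ ℓ′ ≔ n ]) [ ℓ ≔ m ] ≗ (σ [ ℓ ≔ m ]) [ ℓ′ ≔ n ]
≔-comm {ℓ} {ℓ′} {σ} ℓ≢ℓ′ k with k ≟ ℓ | k ≟ ℓ′
... | yes refl | yes refl = contradiction refl ℓ≢ℓ′
... | yes refl | no _     = sym (≔-same {σ} {ℓ})
... | no _     | yes refl = ≔-same {σ} {ℓ′}
... | no k≢ℓ   | no k≢ℓ′  = trans (≔-other {σ = σ} k≢ℓ′) (sym (≔-other {σ = σ} k≢ℓ))

≔-cong : σ ≗ τ → m ≡ n → σ [ ℓ ≔ m ] ≗ τ [ ℓ ≔ n ]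
≔-cong {ℓ = ℓ} σ≗τ refl k with k ≟ ℓ
... | yes _ = refl
... | no _  = σ≗τ k

-- vvar 0 is a junk value for lookups outside the domain (ill-formed terms).
mutual
  ⟦_⟧ : Store → Map
  ⟦ emp ⟧       = λ _ → nothing
  ⟦ upd ℓ u s ⟧ = ⟦ s ⟧ [ ℓ ≔ just (ev u) ]

  ev : Lookup → Val
  ev (val V)   = V
  ev (lkp ℓ s) = fromMaybe (vvar 0) (⟦ s ⟧ ℓ)

ev-lkp : ⟦ s ⟧ ℓ ≡ just V → ev (lkp ℓ s) ≡ V
ev-lkp = cong (fromMaybe (vvar 0))

∈dom⇒≡just : ℓ ∈dom s → ⟦ s ⟧ ℓ ≡ just (ev (lkp ℓ s))
∈dom⇒≡just {ℓ = ℓ} {s = upd ℓ′ u s} _ with ℓ ≟ ℓ′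
∈dom⇒≡just _         | yes _  = refl
∈dom⇒≡just here      | no ℓ≢ℓ = contradiction refl ℓ≢ℓ
∈dom⇒≡just (there p) | no _   = ∈dom⇒≡just p

≡just⇒∈dom : ⟦ s ⟧ ℓ ≡ just V → ℓ ∈dom s
≡just⇒∈dom {s = upd ℓ′ u s} {ℓ} eq with ℓ ≟ ℓ′
... | yes refl = here
... | no _     = there (≡just⇒∈dom eq)

mutual
  ⟦⟧-sound : s ≈S t → ⟦ s ⟧ ≗ ⟦ t ⟧
  ⟦⟧-sound (reflS _)       k = refl
  ⟦⟧-sound (symS e)        k = sym (⟦⟧-sound e k)
  ⟦⟧-sound (transS e e′)   k = trans (⟦⟧-sound e k) (⟦⟧-sound e′ k)
  ⟦⟧-sound (congUpd eu es) k = ≔-cong (⟦⟧-sound es) (cong just (ev-sound eu)) k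
  ⟦⟧-sound (ax3 _ ℓ∈s)     k = ≔-self (∈dom⇒≡just ℓ∈s) k
  ⟦⟧-sound (ax4 _)         k = ≔-overwrite k
  ⟦⟧-sound (ax5 ℓ≢ℓ′ _)    k = ≔-comm ℓ≢ℓ′ k

  ev-sound : u ≈L u′ → ev u ≡ ev u′
  ev-sound (reflL _)             = refl
  ev-sound (symL e)              = sym (ev-sound e)
  ev-sound (transL e e′)         = trans (ev-sound e) (ev-sound e′)
  ev-sound (congLkp {ℓ} _ _ e)   = cong (fromMaybe (vvar 0)) (⟦⟧-sound e ℓ)
  ev-sound (ax1 {ℓ} {u} {s} _ _) = ev-lkp {upd ℓ u s} {ℓ} (≔-same {⟦ s ⟧} {ℓ})
  ev-sound (ax2 {u = u} {s} ℓ≢ℓ′ _ _ _) =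
    cong (fromMaybe (vvar 0)) (≔-other {σ = ⟦ s ⟧} {m = just (ev u)} ℓ≢ℓ′)

≈S-∈dom : s ≈S t → ℓ ∈dom s → ℓ ∈dom t
≈S-∈dom {ℓ = ℓ} e ℓ∈s = ≡just⇒∈dom (trans (sym (⟦⟧-sound e ℓ)) (∈dom⇒≡just ℓ∈s))

≈S⇒≃ : s ≈S t → s ≃ t
≈S⇒≃ e = (λ _ → mk⇔ (≈S-∈dom e) (≈S-∈dom (symS e)))
       , (λ _ ℓ∈s → congLkp ℓ∈s (≈S-∈dom e ℓ∈s) e)

≃⇒⟦⟧≗ : s ≃ t → ⟦ s ⟧ ≗ ⟦ t ⟧
≃⇒⟦⟧≗ {s} {t} (dom , lkps) k with ⟦ s ⟧ k in eqs | ⟦ t ⟧ k in eqt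
... | just V  | just W  = begin
  just V               ≡⟨ sym eqs ⟩
  ⟦ s ⟧ k              ≡⟨ ∈dom⇒≡just k∈s ⟩
  just (ev (lkp k s))  ≡⟨ cong just (ev-sound (lkps k k∈s)) ⟩
  just (ev (lkp k t))  ≡⟨ cong just (ev-lkp {t} eqt) ⟩
  just W               ∎
  where
  open ≡-Reasoning
  k∈s : k ∈dom s
  k∈s = ≡just⇒∈dom eqs
... | just _  | nothing =
  contradiction (trans (sym eqt) (∈dom⇒≡just (Equivalence.to (dom k) (≡just⇒∈dom eqs)))) λ ()
... | nothing | just _  =
  contradiction (trans (sym eqs) (∈dom⇒≡just (Equivalence.from (dom k) (≡just⇒∈dom eqt)))) λ ()
... | nothing | nothing = refl

mutual
  lookup≈val : WfL u → u ≈L val (ev u)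
  lookup≈val val          = reflL val
  lookup≈val (lkp ws ℓ∈s) = lkp≈val ws (∈dom⇒≡just ℓ∈s)

  lkp≈val : WfS s → ⟦ s ⟧ ℓ ≡ just V → lkp ℓ s ≈L val V
  lkp≈val {ℓ = ℓ} (upd {ℓ′} wu ws) eq with ℓ ≟ ℓ′
  ... | yes refl = subst (λ W → _ ≈L val W) (just-injective eq) (transL (ax1 wu ws) (lookup≈val wu))
  ... | no ℓ≢ℓ′  = transL (ax2 ℓ≢ℓ′ wu ws (≡just⇒∈dom eq)) (lkp≈val ws eq)

upd-current : WfS s → ⟦ s ⟧ ℓ ≡ just V → s ≈S upd ℓ (val V) s
upd-current ws eq =
  symS (transS (congUpd (symL (lkp≈val ws eq)) (reflS ws)) (ax3 ws (≡just⇒∈dom eq)))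

data ValStore : Set where
  vemp : ValStore
  vupd : Loc → Val → ValStore → ValStore

⌊_⌋ : ValStore → Store
⌊ vemp ⌋       = emp
⌊ vupd ℓ V a ⌋ = upd ℓ (val V) ⌊ a ⌋

⌊⌋-wf : ∀ a → WfS ⌊ a ⌋
⌊⌋-wf vemp         = emp
⌊⌋-wf (vupd _ _ a) = upd val (⌊⌋-wf a)

size : ValStore → ℕ
size vemp         = 0
size (vupd _ _ a) = suc (size a)

normalise : Store → ValStore
normalise emp         = vemp
normalise (upd ℓ u s) = vupd ℓ (ev u) (normalise s)

≈normalise : WfS s → s ≈S ⌊ normalise s ⌋
≈normalise emp         = reflS emp
≈normalise (upd wu ws) = congUpd (lookup≈val wu) (≈normalise ws)

delete : Loc → ValStore → ValStore
delete ℓ vemp = vemp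
delete ℓ (vupd ℓ′ V a) with ℓ ≟ ℓ′
... | yes _ = delete ℓ a
... | no _  = vupd ℓ′ V (delete ℓ a)

size-delete : ∀ ℓ a → size (delete ℓ a) ≤ size a
size-delete ℓ vemp = ≤-refl
size-delete ℓ (vupd ℓ′ _ a) with ℓ ≟ ℓ′
... | yes _ = m≤n⇒m≤1+n (size-delete ℓ a)
... | no _  = s≤s (size-delete ℓ a)

⟦delete⟧ : ∀ ℓ a → ⟦ ⌊ delete ℓ a ⌋ ⟧ ≗ ⟦ ⌊ a ⌋ ⟧ [ ℓ ≔ nothing ]
⟦delete⟧ ℓ vemp k = sym (≔-self refl k)
⟦delete⟧ ℓ (vupd ℓ′ W a) k with ℓ ≟ ℓ′
... | yes refl = trans (⟦delete⟧ ℓ a k) (sym (≔-overwrite k))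
... | no ℓ≢ℓ′  = trans (≔-cong (⟦delete⟧ ℓ a) refl k) (sym (≔-comm ℓ≢ℓ′ k))

upd-absorb : ∀ ℓ V a → upd ℓ (val V) ⌊ a ⌋ ≈S upd ℓ (val V) ⌊ delete ℓ a ⌋
upd-absorb ℓ V vemp = reflS (upd val emp)
upd-absorb ℓ V (vupd ℓ′ W a) with ℓ ≟ ℓ′
... | yes refl = transS (ax4 (⌊⌋-wf a)) (upd-absorb ℓ V a)
... | no ℓ≢ℓ′  = transS (ax5 ℓ≢ℓ′ (⌊⌋-wf a))
                   (transS (congUpd (reflL val) (upd-absorb ℓ V a))
                     (symS (ax5 ℓ≢ℓ′ (⌊⌋-wf (delete ℓ a)))))

⌊⌋-complete : ∀ a b → Acc _<_ (size a) → ⟦ ⌊ a ⌋ ⟧ ≗ ⟦ ⌊ b ⌋ ⟧ → ⌊ a ⌋ ≈S ⌊ b ⌋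
⌊⌋-complete vemp vemp         _ _   = reflS emp
⌊⌋-complete vemp (vupd ℓ W b) _ a≗b =
  contradiction (trans (a≗b ℓ) (≔-same {⟦ ⌊ b ⌋ ⟧} {ℓ})) λ ()
⌊⌋-complete (vupd ℓ V a) b (acc rs) a≗b =
  transS (upd-absorb ℓ V a)
    (transS (congUpd (reflL val) rest≈rest)
      (symS (transS (upd-current (⌊⌋-wf b) bℓ≡V) (upd-absorb ℓ V b))))
  where
  bℓ≡V : ⟦ ⌊ b ⌋ ⟧ ℓ ≡ just V
  bℓ≡V = trans (sym (a≗b ℓ)) (≔-same {⟦ ⌊ a ⌋ ⟧} {ℓ})

  rest≗rest : ⟦ ⌊ delete ℓ a ⌋ ⟧ ≗ ⟦ ⌊ delete ℓ b ⌋ ⟧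
  rest≗rest k = begin
    ⟦ ⌊ delete ℓ a ⌋ ⟧ k                                ≡⟨ ⟦delete⟧ ℓ a k ⟩
    (⟦ ⌊ a ⌋ ⟧ [ ℓ ≔ nothing ]) k                       ≡⟨ sym (≔-overwrite k) ⟩
    ((⟦ ⌊ a ⌋ ⟧ [ ℓ ≔ just V ]) [ ℓ ≔ nothing ]) k      ≡⟨ ≔-cong a≗b refl k ⟩
    (⟦ ⌊ b ⌋ ⟧ [ ℓ ≔ nothing ]) k                       ≡⟨ sym (⟦delete⟧ ℓ b k) ⟩
    ⟦ ⌊ delete ℓ b ⌋ ⟧ k                                ∎
    where open ≡-Reasoning

  rest≈rest : ⌊ delete ℓ a ⌋ ≈S ⌊ delete ℓ b ⌋
  rest≈rest = ⌊⌋-complete (delete ℓ a) (delete ℓ b) (rs (s≤s (size-delete ℓ a))) rest≗rest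

⟦⟧-complete : WfS s → WfS t → ⟦ s ⟧ ≗ ⟦ t ⟧ → s ≈S t
⟦⟧-complete {s} {t} ws wt s≗t =
  transS (≈normalise ws)
    (transS (⌊⌋-complete (normalise s) (normalise t) (<-wellFounded _) nf≗nf)
      (symS (≈normalise wt)))
  where
  nf≗nf : ⟦ ⌊ normalise s ⌋ ⟧ ≗ ⟦ ⌊ normalise t ⌋ ⟧
  nf≗nf k = trans (sym (⟦⟧-sound (≈normalise ws) k))
              (trans (s≗t k) (⟦⟧-sound (≈normalise wt) k))

mainTheorem6 : (s t : Store) → WfS s → WfS t → (s ≈S t) ⇔ (s ≃ t)
mainTheorem6 s t ws wt = mk⇔ ≈S⇒≃ (⟦⟧-complete ws wt ∘ ≃⇒⟦⟧≗)
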